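{- In $\mathsf{LEM}$: (1) every type of the form $\S\sigma$ is closed and lazy; (2) every closed type has at least one positive occurrence of $\forall$; (3) if $\rho$ is an instance of $\forall\mathrm{L}$, $d$, $w$, $c$, or of $p$ with a non-empty context, then the conclusion of $\rho$ is not a lazy judgment; (4) if $\rho$ is an instance of ax, $\multimap\mathrm{R}$, $\multimap\mathrm{L}$, $\forall\mathrm{R}$, or of $p$ with empty context, and the conclusion of $\rho$ is lazy, then every premise of $\rho$ is lazy; (5) if $\mathcal{D}$ is a cut-free lazy derivation, then all its judgments are lazy and $\mathcal{D}$ contains no instance of $\forall\mathrm{L}$, $d$, $w$, $c$, nor of $p$ with a non-empty context.
   Context: $\mathsf{LEM}$: linear types $A ::= \alpha \mid \sigma\multimap A \mid \forall\alpha.A$; types $\sigma ::= A \mid \S\sigma$, where in $\S\sigma$ the type $\sigma$ is closed with no negative occurrence of $\forall$. Polarity: the whole type is positive; in $\sigma\multimap A$ occurrences inside $A$ keep polarity, those inside $\sigma$ reverse it; $\forall\alpha.(\cdot)$, $\S(\cdot)$ preserve it. Values are closed $\beta$-normal linear $\lambda$-terms. Terms: $x\mid\lambda x.M\mid MN\mid\mathtt{discard}_\sigma\,M\ \mathtt{in}\ N\mid\mathtt{copy}^V_\sigma\,M\ \mathtt{as}\ x,y\ \mathtt{in}\ N$ ($V$ a value), linear only. Typing rules (contexts of distinct variables): (ax) $x:A\vdash x:A$, $A$ linear; (cut) from $\Gamma\vdash N:\sigma$, $\Delta,x:\sigma\vdash M:\tau$ infer $\Gamma,\Delta\vdash M[N/x]:\tau$;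 ($\multimap$R) from $\Gamma,x:\sigma\vdash M:B$ infer $\Gamma\vdash\lambda x.M:\sigma\multimap B$; ($\multimap$L) from $\Gamma\vdash N:\sigma$, $\Delta,x:B\vdash M:\tau$ infer $\Gamma,\Delta,y:\sigma\multimap B\vdash M[yN/x]:\tau$; ($\forall$R) from $\Gamma\vdash M:A\langle\gamma/\alpha\rangle$, $\gamma$ not free in $\Gamma$, infer $\Gamma\vdash M:\forall\alpha.A$; ($\forall$L) from $\Gamma,x:A\langle B/\alpha\rangle\vdash M:\tau$ infer $\Gamma,x:\forall\alpha.A\vdash M:\tau$; ($p$) from $x_1:\S\sigma_1,\dots,x_n:\S\sigma_n\vdash M:\sigma$ infer the same context $\vdash M:\S\sigma$; ($d$) from $\Gamma,x:\sigma\vdash M:\tau$ infer $\Gamma,y:\S\sigma\vdash M[y/x]:\tau$; ($w$) from $\Gamma\vdash M:\tau$ infer $\Gamma,x:\S\sigma\vdash\mathtt{discard}_\sigma\,x\ \mathtt{in}\ M:\tau$; ($c$) from $\Gamma,y:\S\sigma,z:\S\sigma\vdash M:\tau$ and $\vdash V:\sigma$ infer $\Gamma,x:\S\sigma\vdash\mathtt{copy}^V_\sigma\,x\ \mathtt{as}\ y,z\ \mathtt{in}\ M:\tau$. A type is lazy if it contains no negative occurrence of $\forall$. A judgment $x_1:\sigma_1,\dots,x_n:\sigma_n\vdash M:\tau$ is lazy if $\tau$ is lazy and $\sigma_1,\dots,\sigma_n$ contain no positive occurrence of $\forall$. A derivation is lazy if its conclusion is a lazy judgment. -}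

module Defs where

open import Data.Nat using (ℕ; zero; suc; _+_; _<ᵇ_; _≡ᵇ_; pred)
open import Data.Nat.Properties using (<-cmp)
open import Data.Bool using (Bool; true; false; _∨_; _∧_; if_then_else_)
open import Data.List using (List; []; _∷_; _++_; map; [_])
open import Data.List.Relation.Unary.All using (All)
open import Data.List.Relation.Unary.Unique.Propositional using (Unique)
open import Data.List.Relation.Binary.Permutation.Propositional using (_↭_)
open import Data.Product using (_×_; _,_; proj₁; proj₂)
open import Data.Unit using (⊤)
open import Data.Sum using (_⊎_)
open import Data.Empty using (⊥)
open import Relation.Binary.PropositionalEquality using (_≡_; _≢_)
open import Relation.Binary.Definitions using (tri<; tri≈; tri>)
open import Relation.Nullary using (¬_)

-- Types of LEM (type variables as de Bruijn indices; `∀' binds index 0).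
-- Linear types  A ::= α | σ ⊸ A | ∀α.A
-- Types         σ ::= A | §σ   where in §σ, σ is closed and has no
--                                negative occurrence of ∀.
-- The side condition on § is enforced intrinsically (induction-recursion).

infixr 20 _⊸_

mutual
  data LTy : Set where
    var : ℕ → LTy
    _⊸_ : Ty → LTy → LTy
    `∀  : LTy → LTy

  data Ty : Set where
    lin : LTy → Ty
    §   : (σ : Ty) → closedTy 0 σ ≡ true → neg∀ σ ≡ false → Ty

  closedL : ℕ → LTy → Bool
  closedL k (var i) = i <ᵇ k
  closedL k (σ ⊸ A) = closedTy k σ ∧ closedL k A
  closedL k (`∀ A)  = closedL (suc k) A

  closedTy : ℕ → Ty → Bool
  closedTy k (lin A)     = closedL k A
  closedTy k (§ σ _ _)   = closedTy k σ

  pos∀L : LTy → Bool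
  pos∀L (var i) = false
  pos∀L (σ ⊸ A) = neg∀ σ ∨ pos∀L A
  pos∀L (`∀ A)  = true

  neg∀L : LTy → Bool
  neg∀L (var i) = false
  neg∀L (σ ⊸ A) = pos∀ σ ∨ neg∀L A
  neg∀L (`∀ A)  = neg∀L A

  pos∀ : Ty → Bool
  pos∀ (lin A)   = pos∀L A
  pos∀ (§ σ _ _) = pos∀ σ

  neg∀ : Ty → Bool
  neg∀ (lin A)   = neg∀L A
  neg∀ (§ σ _ _) = neg∀ σ

Closed : Ty → Set
Closed σ = closedTy 0 σ ≡ true

HasPos∀ : Ty → Set
HasPos∀ σ = pos∀ σ ≡ true

HasNeg∀ : Ty → Set
HasNeg∀ σ = neg∀ σ ≡ true

LazyTy : Ty → Set
LazyTy σ = neg∀ σ ≡ false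

-- Type substitution A⟨B/α⟩ (de Bruijn; § types are closed, hence fixed).

mutual
  shiftL : ℕ → LTy → LTy
  shiftL c (var i) = if i <ᵇ c then var i else var (suc i)
  shiftL c (σ ⊸ A) = shiftTy c σ ⊸ shiftL c A
  shiftL c (`∀ A)  = `∀ (shiftL (suc c) A)

  shiftTy : ℕ → Ty → Ty
  shiftTy c (lin A)     = lin (shiftL c A)
  shiftTy c (§ σ cl lz) = § σ cl lz

shiftN : ℕ → LTy → LTy
shiftN zero    B = B
shiftN (suc n) B = shiftL 0 (shiftN n B)

mutual
  substL : LTy → ℕ → LTy → LTy
  substL B k (var i) with <-cmp i k
  ... | tri< _ _ _ = var i
  ... | tri≈ _ _ _ = shiftN k B
  ... | tri> _ _ _ = var (pred i)
  substL B k (σ ⊸ A) = substTy B k σ ⊸ substL B k A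
  substL B k (`∀ A)  = `∀ (substL B (suc k) A)

  substTy : LTy → ℕ → Ty → Ty
  substTy B k (lin A)     = lin (substL B k A)
  substTy B k (§ σ cl lz) = § σ cl lz

_⟨_/α⟩ : LTy → LTy → LTy
A ⟨ B /α⟩ = substL B 0 A

-- the free type variable with index g occurs in σ (below k binders)
mutual
  freeL : ℕ → ℕ → LTy → Bool
  freeL k g (var i) = i ≡ᵇ (g + k)
  freeL k g (σ ⊸ A) = freeTy k g σ ∨ freeL k g A
  freeL k g (`∀ A)  = freeL (suc k) g A

  freeTy : ℕ → ℕ → Ty → Bool
  freeTy k g (lin A)   = freeL k g A
  freeTy k g (§ σ _ _) = freeTy k g σ

data Term : Set where
  v_      : ℕ → Term
  ƛ_⇒_    : ℕ → Term → Term
  _·_     : Term → Term → Term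
  discard : Ty → Term → Term → Term
  -- copy^V_σ M as x , y in N   is   copy σ V M x y N
  copy    : Ty → Term → Term → ℕ → ℕ → Term → Term

-- M [ N / x ]  (substitution of N for the free occurrences of x;
-- bound variables are assumed distinct from free ones, Barendregt convention)
_[_/_] : Term → Term → ℕ → Term
(v y) [ N / x ] = if y ≡ᵇ x then N else v y
(ƛ y ⇒ M) [ N / x ] = if y ≡ᵇ x then ƛ y ⇒ M else ƛ y ⇒ (M [ N / x ])
(M₁ · M₂) [ N / x ] = (M₁ [ N / x ]) · (M₂ [ N / x ])
discard σ M₁ M₂ [ N / x ] = discard σ (M₁ [ N / x ]) (M₂ [ N / x ])
copy σ V M₁ y z M₂ [ N / x ] =
  copy σ V (M₁ [ N / x ])
       y z (if (y ≡ᵇ x) ∨ (z ≡ᵇ x) then M₂ else (M₂ [ N / x ]))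

occ : ℕ → Term → ℕ
occ x (v y) = if y ≡ᵇ x then 1 else 0
occ x (ƛ y ⇒ M) = if y ≡ᵇ x then 0 else occ x M
occ x (M · N) = occ x M + occ x N
occ x (discard σ M N) = occ x M + occ x N
occ x (copy σ V M y z N) =
  occ x V + occ x M + (if (y ≡ᵇ x) ∨ (z ≡ᵇ x) then 0 else occ x N)

notLam : Term → Set
notLam (ƛ _ ⇒ _) = ⊥
notLam _ = ⊤

PureNormal : Term → Set
PureNormal (v x) = ⊤
PureNormal (ƛ x ⇒ M) = PureNormal M
PureNormal (M · N) = notLam M × PureNormal M × PureNormal N
PureNormal (discard _ _ _) = ⊥
PureNormal (copy _ _ _ _ _ _) = ⊥

LinearTm : Term → Set
LinearTm (v x) = ⊤
LinearTm (ƛ x ⇒ M) = (occ x M ≡ 1) × LinearTm M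
LinearTm (M · N) = LinearTm M × LinearTm N
LinearTm (discard _ _ _) = ⊥
LinearTm (copy _ _ _ _ _ _) = ⊥

ClosedTm : Term → Set
ClosedTm M = ∀ x → occ x M ≡ 0

IsValue : Term → Set
IsValue V = PureNormal V × LinearTm V × ClosedTm V

Ctx : Set
Ctx = List (ℕ × Ty)

infix 4 _⊢_∶_
record Judgment : Set where
  constructor _⊢_∶_
  field
    ctx  : Ctx
    term : Term
    type : Ty
open Judgment public

DistinctJ : Judgment → Set
DistinctJ J = Unique (map proj₁ (ctx J))

_≈J_ : Judgment → Judgment → Set
J ≈J K = (ctx J ↭ ctx K) × (term J ≡ term K) × (type J ≡ type K)

LazyJ : Judgment → Set
LazyJ J = LazyTy (type J) × All (λ xσ → pos∀ (proj₂ xσ) ≡ false) (ctx J)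

data RuleName : Set where
  r-ax r-cut r-⊸R r-⊸L r-∀R r-∀L r-p r-d r-w r-c : RuleName

IsSection : Ty → Set
IsSection (lin _) = ⊥
IsSection (§ _ _ _) = ⊤

data RawInst : Set where
  ax  : (x : ℕ) (A : LTy) → RawInst
  cut : (Γ Δ : Ctx) (x : ℕ) (N M : Term) (σ τ : Ty) → RawInst
  ⊸R  : (Γ : Ctx) (x : ℕ) (σ : Ty) (M : Term) (B : LTy) → RawInst
  ⊸L  : (Γ Δ : Ctx) (N : Term) (σ : Ty) (x : ℕ) (B : LTy) (M : Term)
        (τ : Ty) (y : ℕ) → RawInst
  -- ∀R with eigenvariable γ = the free type variable of index g
  ∀R  : (Γ : Ctx) (M : Term) (A : LTy) (g : ℕ) →
        All (λ xσ → freeTy 0 g (proj₂ xσ) ≡ false) Γ → RawInst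
  ∀L  : (Γ : Ctx) (x : ℕ) (A B : LTy) (M : Term) (τ : Ty) → RawInst
  p   : (Θ : Ctx) → All (λ xσ → IsSection (proj₂ xσ)) Θ →
        (M : Term) (σ : Ty) (cl : closedTy 0 σ ≡ true)
        (lz : neg∀ σ ≡ false) → RawInst
  d   : (Γ : Ctx) (x : ℕ) (σ : Ty) (cl : closedTy 0 σ ≡ true)
        (lz : neg∀ σ ≡ false) (y : ℕ) (M : Term) (τ : Ty) → RawInst
  w   : (Γ : Ctx) (M : Term) (τ : Ty) (x : ℕ) (σ : Ty)
        (cl : closedTy 0 σ ≡ true) (lz : neg∀ σ ≡ false) → RawInst
  c   : (Γ : Ctx) (y z : ℕ) (M : Term) (τ : Ty) (σ : Ty)
        (cl : closedTy 0 σ ≡ true) (lz : neg∀ σ ≡ false)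
        (V : Term) → IsValue V → (x : ℕ) → RawInst

ruleName : RawInst → RuleName
ruleName (ax _ _) = r-ax
ruleName (cut _ _ _ _ _ _ _) = r-cut
ruleName (⊸R _ _ _ _ _) = r-⊸R
ruleName (⊸L _ _ _ _ _ _ _ _ _) = r-⊸L
ruleName (∀R _ _ _ _ _) = r-∀R
ruleName (∀L _ _ _ _ _ _) = r-∀L
ruleName (p _ _ _ _ _ _) = r-p
ruleName (d _ _ _ _ _ _ _ _) = r-d
ruleName (w _ _ _ _ _ _ _) = r-w
ruleName (c _ _ _ _ _ _ _ _ _ _ _) = r-c

conclR : RawInst → Judgment
conclR (ax x A) = [ (x , lin A) ] ⊢ v x ∶ lin A
conclR (cut Γ Δ x N M σ τ) = Γ ++ Δ ⊢ M [ N / x ] ∶ τ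
conclR (⊸R Γ x σ M B) = Γ ⊢ ƛ x ⇒ M ∶ lin (σ ⊸ B)
conclR (⊸L Γ Δ N σ x B M τ y) =
  Γ ++ Δ ++ [ (y , lin (σ ⊸ B)) ] ⊢ M [ (v y) · N / x ] ∶ τ
conclR (∀R Γ M A g _) = Γ ⊢ M ∶ lin (`∀ A)
conclR (∀L Γ x A B M τ) = Γ ++ [ (x , lin (`∀ A)) ] ⊢ M ∶ τ
conclR (p Θ _ M σ cl lz) = Θ ⊢ M ∶ § σ cl lz
conclR (d Γ x σ cl lz y M τ) = Γ ++ [ (y , § σ cl lz) ] ⊢ M [ v y / x ] ∶ τ
conclR (w Γ M τ x σ cl lz) = Γ ++ [ (x , § σ cl lz) ] ⊢ discard σ (v x) M ∶ τ
conclR (c Γ y z M τ σ cl lz V _ x) =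
  Γ ++ [ (x , § σ cl lz) ] ⊢ copy σ V (v x) y z M ∶ τ

premsR : RawInst → List Judgment
premsR (ax x A) = []
premsR (cut Γ Δ x N M σ τ) = (Γ ⊢ N ∶ σ) ∷ (Δ ++ [ (x , σ) ] ⊢ M ∶ τ) ∷ []
premsR (⊸R Γ x σ M B) = (Γ ++ [ (x , σ) ] ⊢ M ∶ lin B) ∷ []
premsR (⊸L Γ Δ N σ x B M τ y) =
  (Γ ⊢ N ∶ σ) ∷ (Δ ++ [ (x , lin B) ] ⊢ M ∶ τ) ∷ []
premsR (∀R Γ M A g _) = (Γ ⊢ M ∶ lin (A ⟨ var g /α⟩)) ∷ []
premsR (∀L Γ x A B M τ) = (Γ ++ [ (x , lin (A ⟨ B /α⟩)) ] ⊢ M ∶ τ) ∷ []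
premsR (p Θ _ M σ cl lz) = (Θ ⊢ M ∶ σ) ∷ []
premsR (d Γ x σ cl lz y M τ) = (Γ ++ [ (x , σ) ] ⊢ M ∶ τ) ∷ []
premsR (w Γ M τ x σ cl lz) = (Γ ⊢ M ∶ τ) ∷ []
premsR (c Γ y z M τ σ cl lz V _ x) =
  (Γ ++ (y , § σ cl lz) ∷ (z , § σ cl lz) ∷ [] ⊢ M ∶ τ) ∷ ([] ⊢ V ∶ σ) ∷ []

record Instance : Set where
  constructor inst
  field
    raw : RawInst
    wf  : All DistinctJ (conclR raw ∷ premsR raw)

rule : Instance → RuleName
rule ρ = ruleName (Instance.raw ρ)

concl : Instance → Judgment
concl ρ = conclR (Instance.raw ρ)

prems : Instance → List Judgment
prems ρ = premsR (Instance.raw ρ)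

Forbidden : Instance → Set
Forbidden ρ = (rule ρ ≡ r-∀L) ⊎ (rule ρ ≡ r-d) ⊎ (rule ρ ≡ r-w)
            ⊎ (rule ρ ≡ r-c) ⊎ ((rule ρ ≡ r-p) × (ctx (concl ρ) ≢ []))

Kind4 : Instance → Set
Kind4 ρ = (rule ρ ≡ r-ax) ⊎ (rule ρ ≡ r-⊸R) ⊎ (rule ρ ≡ r-⊸L)
        ⊎ (rule ρ ≡ r-∀R) ⊎ ((rule ρ ≡ r-p) × (ctx (concl ρ) ≡ []))

-- Derivations (contexts identified up to permutation)

mutual
  data Deriv : Judgment → Set where
    node : (ρ : Instance) {J : Judgment} → concl ρ ≈J J →
           Derivs (prems ρ) → Deriv J

  data Derivs : List Judgment → Set where
    []  : Derivs []
    _∷_ : ∀ {J Js} → Deriv J → Derivs Js → Derivs (J ∷ Js)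

mutual
  AllNodes : (Instance → Set) → ∀ {J} → Deriv J → Set
  AllNodes P (node ρ _ ds) = P ρ × AllNodesL P ds

  AllNodesL : (Instance → Set) → ∀ {Js} → Derivs Js → Set
  AllNodesL P [] = ⊤
  AllNodesL P (D ∷ Ds) = AllNodes P D × AllNodesL P Ds

CutFree : ∀ {J} → Deriv J → Set
CutFree D = AllNodes (λ ρ → rule ρ ≢ r-cut) D

-- A lazy judgment has no positive ∀ in its context. Every closed type has a
-- positive ∀, because the target of a closed linear type cannot be a type
-- variable; in particular so does every §-type. The rules ∀L, d, w, c and p
-- with a non-empty context all place a ∀-type or a §-type in the context of
-- their conclusion, so their conclusions are not lazy. The other rules move
-- types across ⊢ exactly when they flip polarity, and the eigenvariable
-- substitution of ∀R is a renaming, which preserves polarities; so laziness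
-- propagates from conclusions to premises, and by induction through every
-- cut-free lazy derivation.
module Submission where

open import Defs
open import Data.Product using (_×_)
open import Data.List.Relation.Unary.All using (All)
open import Relation.Binary.PropositionalEquality using (_≡_)
open import Relation.Nullary using (¬_)

open import Data.Nat using (zero; suc; _+_)
open import Data.Nat.Properties using (<-cmp)
open import Data.Bool using (true; false; _∨_)
open import Data.Bool.Properties using (∨-zeroʳ; ∨-conicalˡ; ∨-conicalʳ; ∧-conicalʳ; not-¬)
open import Data.List using ([]; _∷_)
open import Data.List.Relation.Unary.All using ([]; _∷_; lookupWith)
open import Data.List.Relation.Unary.All.Properties using (++⁺; ++⁻ˡ; ++⁻ʳ)
open import Data.List.Relation.Unary.Any using (Any; here)
open import Data.List.Relation.Unary.Any.Properties using (++⁺ʳ)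
open import Data.List.Relation.Binary.Permutation.Propositional using (↭-sym)
open import Data.List.Relation.Binary.Permutation.Propositional.Properties using (All-resp-↭)
open import Data.Product using (_,_; proj₂)
open import Data.Sum using (inj₁; inj₂)
open import Data.Unit using (⊤; tt)
open import Data.Empty using (⊥; ⊥-elim)
open import Function using (_∘_)
open import Relation.Binary.Definitions using (tri<; tri≈; tri>)
open import Relation.Binary.PropositionalEquality using (_≢_; refl; sym; trans; cong; cong₂)

closed⇒hasPos∀L : ∀ A → closedL 0 A ≡ true → pos∀L A ≡ true
closed⇒hasPos∀L (var i) ()
closed⇒hasPos∀L (σ ⊸ A) cl =
  trans (cong (neg∀ σ ∨_) (closed⇒hasPos∀L A (∧-conicalʳ (closedTy 0 σ) _ cl))) (∨-zeroʳ (neg∀ σ))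
closed⇒hasPos∀L (`∀ A) _ = refl

closed⇒hasPos∀ : ∀ σ → Closed σ → HasPos∀ σ
closed⇒hasPos∀ (lin A)   cl = closed⇒hasPos∀L A cl
closed⇒hasPos∀ (§ σ _ _) cl = closed⇒hasPos∀ σ cl

shiftN-var : ∀ n g → shiftN n (var g) ≡ var (n + g)
shiftN-var zero    g = refl
shiftN-var (suc n) g = cong (shiftL 0) (shiftN-var n g)

mutual
  pos∀L-rename : ∀ g k A → pos∀L (substL (var g) k A) ≡ pos∀L A
  pos∀L-rename g k (var i) with <-cmp i k
  ... | tri< _ _ _ = refl
  ... | tri≈ _ _ _ = cong pos∀L (shiftN-var k g)
  ... | tri> _ _ _ = refl
  pos∀L-rename g k (σ ⊸ A) = cong₂ _∨_ (neg∀-rename g k σ) (pos∀L-rename g k A)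
  pos∀L-rename g k (`∀ A)  = refl

  neg∀L-rename : ∀ g k A → neg∀L (substL (var g) k A) ≡ neg∀L A
  neg∀L-rename g k (var i) with <-cmp i k
  ... | tri< _ _ _ = refl
  ... | tri≈ _ _ _ = cong neg∀L (shiftN-var k g)
  ... | tri> _ _ _ = refl
  neg∀L-rename g k (σ ⊸ A) = cong₂ _∨_ (pos∀-rename g k σ) (neg∀L-rename g k A)
  neg∀L-rename g k (`∀ A)  = neg∀L-rename g (suc k) A

  pos∀-rename : ∀ g k σ → pos∀ (substTy (var g) k σ) ≡ pos∀ σ
  pos∀-rename g k (lin A)   = pos∀L-rename g k A
  pos∀-rename g k (§ _ _ _) = refl

  neg∀-rename : ∀ g k σ → neg∀ (substTy (var g) k σ) ≡ neg∀ σ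
  neg∀-rename g k (lin A)   = neg∀L-rename g k A
  neg∀-rename g k (§ _ _ _) = refl

NoPos∀Ctx : Ctx → Set
NoPos∀Ctx = All (λ xσ → pos∀ (proj₂ xσ) ≡ false)

hasPos∀-entry⇒¬noPos∀ : ∀ {Γ} → Any (HasPos∀ ∘ proj₂) Γ → ¬ NoPos∀Ctx Γ
hasPos∀-entry⇒¬noPos∀ entry noPos∀ = lookupWith (λ no yes → not-¬ yes no) noPos∀ entry

-- Forbidden computed from the rule name, so that the other rules are refuted
-- by an absurd pattern instead of a case split on the five disjuncts.
ForbiddenShape : RuleName → Ctx → Set
ForbiddenShape r-∀L _ = ⊤
ForbiddenShape r-d  _ = ⊤
ForbiddenShape r-w  _ = ⊤
ForbiddenShape r-c  _ = ⊤
ForbiddenShape r-p  Θ = Θ ≢ []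
ForbiddenShape _    _ = ⊥

shape-along : ∀ {r s Θ} → r ≡ s → ForbiddenShape s Θ → ForbiddenShape r Θ
shape-along refl shape = shape

forbidden⇒shape : ∀ ρ → Forbidden ρ → ForbiddenShape (rule ρ) (ctx (concl ρ))
forbidden⇒shape ρ (inj₁ is∀L)                              = shape-along is∀L tt
forbidden⇒shape ρ (inj₂ (inj₁ isd))                        = shape-along isd tt
forbidden⇒shape ρ (inj₂ (inj₂ (inj₁ isw)))                 = shape-along isw tt
forbidden⇒shape ρ (inj₂ (inj₂ (inj₂ (inj₁ isc))))          = shape-along isc tt
forbidden⇒shape ρ (inj₂ (inj₂ (inj₂ (inj₂ (isp , Θ≢[]))))) = shape-along isp Θ≢[]

forbiddenShape⇒hasPos∀-entry :
  ∀ r → ForbiddenShape (ruleName r) (ctx (conclR r)) → Any (HasPos∀ ∘ proj₂) (ctx (conclR r))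
forbiddenShape⇒hasPos∀-entry (∀L Γ _ _ _ _ _) _ = ++⁺ʳ Γ (here refl)
forbiddenShape⇒hasPos∀-entry (d Γ _ σ cl _ _ _ _) _ = ++⁺ʳ Γ (here (closed⇒hasPos∀ σ cl))
forbiddenShape⇒hasPos∀-entry (w Γ _ _ _ σ cl _) _ = ++⁺ʳ Γ (here (closed⇒hasPos∀ σ cl))
forbiddenShape⇒hasPos∀-entry (c Γ _ _ _ _ σ cl _ _ _ _) _ = ++⁺ʳ Γ (here (closed⇒hasPos∀ σ cl))
forbiddenShape⇒hasPos∀-entry (p [] _ _ _ _ _) Θ≢[] = ⊥-elim (Θ≢[] refl)
forbiddenShape⇒hasPos∀-entry (p ((_ , lin _) ∷ _) (() ∷ _) _ _ _ _) _
forbiddenShape⇒hasPos∀-entry (p ((_ , § σ cl _) ∷ _) _ _ _ _ _) _ = here (closed⇒hasPos∀ σ cl)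

forbiddenShape⇒¬lazy : ∀ r → ForbiddenShape (ruleName r) (ctx (conclR r)) → ¬ LazyJ (conclR r)
forbiddenShape⇒¬lazy r shape (_ , noPos∀) =
  hasPos∀-entry⇒¬noPos∀ (forbiddenShape⇒hasPos∀-entry r shape) noPos∀

forbidden⇒¬lazy : ∀ (ρ : Instance) → Forbidden ρ → ¬ LazyJ (concl ρ)
forbidden⇒¬lazy ρ f = forbiddenShape⇒¬lazy (Instance.raw ρ) (forbidden⇒shape ρ f)

lazy-premises : ∀ r → ruleName r ≢ r-cut → LazyJ (conclR r) → All LazyJ (premsR r)
lazy-premises (ax _ _) _ _ = []
lazy-premises (cut _ _ _ _ _ _ _) ¬cut _ = ⊥-elim (¬cut refl)
lazy-premises (⊸R _ _ σ _ _) _ (lazy , noPos∀) =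
  (∨-conicalʳ (pos∀ σ) _ lazy , ++⁺ noPos∀ (∨-conicalˡ (pos∀ σ) _ lazy ∷ [])) ∷ []
lazy-premises (⊸L Γ Δ _ σ _ _ _ _ _) _ (lazy , noPos∀) with ++⁻ʳ Δ (++⁻ʳ Γ noPos∀)
... | noPos∀-σ⊸B ∷ [] =
  (∨-conicalˡ (neg∀ σ) _ noPos∀-σ⊸B , ++⁻ˡ Γ noPos∀)
  ∷ (lazy , ++⁺ (++⁻ˡ Δ (++⁻ʳ Γ noPos∀)) (∨-conicalʳ (neg∀ σ) _ noPos∀-σ⊸B ∷ []))
  ∷ []
lazy-premises (∀R _ _ A g _) _ (lazy , noPos∀) = (trans (neg∀L-rename g 0 A) lazy , noPos∀) ∷ []
lazy-premises (p _ _ _ _ _ _) _ lazy = lazy ∷ []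
lazy-premises r@(∀L _ _ _ _ _ _)           _ lazy = ⊥-elim (forbiddenShape⇒¬lazy r tt lazy)
lazy-premises r@(d _ _ _ _ _ _ _ _)        _ lazy = ⊥-elim (forbiddenShape⇒¬lazy r tt lazy)
lazy-premises r@(w _ _ _ _ _ _ _)          _ lazy = ⊥-elim (forbiddenShape⇒¬lazy r tt lazy)
lazy-premises r@(c _ _ _ _ _ _ _ _ _ _ _)  _ lazy = ⊥-elim (forbiddenShape⇒¬lazy r tt lazy)

kind4⇒¬cut : ∀ ρ → Kind4 ρ → rule ρ ≢ r-cut
kind4⇒¬cut ρ (inj₁ isax) isCut with () ← trans (sym isax) isCut
kind4⇒¬cut ρ (inj₂ (inj₁ is⊸R)) isCut with () ← trans (sym is⊸R) isCut
kind4⇒¬cut ρ (inj₂ (inj₂ (inj₁ is⊸L))) isCut with () ← trans (sym is⊸L) isCut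
kind4⇒¬cut ρ (inj₂ (inj₂ (inj₂ (inj₁ is∀R)))) isCut with () ← trans (sym is∀R) isCut
kind4⇒¬cut ρ (inj₂ (inj₂ (inj₂ (inj₂ (isp , _))))) isCut with () ← trans (sym isp) isCut

lazy-resp-≈J : ∀ {J K} → J ≈J K → LazyJ K → LazyJ J
lazy-resp-≈J (J↭K , _ , refl) (lazy , noPos∀) = lazy , All-resp-↭ (↭-sym J↭K) noPos∀

mutual
  cutFree-lazy : ∀ {J} (D : Deriv J) → CutFree D → LazyJ J →
                 AllNodes (λ ρ → LazyJ (concl ρ)) D × AllNodes (λ ρ → ¬ Forbidden ρ) D
  cutFree-lazy (node ρ J≈ ds) (¬cut , cutFree) lazyJ
    with lazyConcl ← lazy-resp-≈J J≈ lazyJ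
    with lazyNodes , allowedNodes ← cutFree-lazy* ds cutFree (lazy-premises (Instance.raw ρ) ¬cut lazyConcl)
    = (lazyConcl , lazyNodes) , ((λ f → forbidden⇒¬lazy ρ f lazyConcl) , allowedNodes)

  cutFree-lazy* : ∀ {Js} (ds : Derivs Js) → AllNodesL (λ ρ → rule ρ ≢ r-cut) ds → All LazyJ Js →
                  AllNodesL (λ ρ → LazyJ (concl ρ)) ds × AllNodesL (λ ρ → ¬ Forbidden ρ) ds
  cutFree-lazy* [] _ _ = tt , tt
  cutFree-lazy* (D ∷ ds) (cutFreeD , cutFreeDs) (lazyD ∷ lazyDs)
    with lazyNodes , allowedNodes ← cutFree-lazy D cutFreeD lazyD
    with lazyNodes* , allowedNodes* ← cutFree-lazy* ds cutFreeDs lazyDs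
    = (lazyNodes , lazyNodes*) , (allowedNodes , allowedNodes*)

lemma5p4 :
    -- (1) every type §σ is closed and lazy
    (∀ σ cl lz → Closed (§ σ cl lz) × LazyTy (§ σ cl lz))
    -- (2) every closed type has a positive occurrence of ∀
    × (∀ σ → Closed σ → HasPos∀ σ)
    -- (3) forbidden rule instances have non-lazy conclusions
    × (∀ (ρ : Instance) → Forbidden ρ → ¬ LazyJ (concl ρ))
    -- (4) the other rules propagate laziness upwards
    × (∀ (ρ : Instance) → Kind4 ρ → LazyJ (concl ρ) → All LazyJ (prems ρ))
    -- (5) cut-free lazy derivations
    × (∀ {J} (D : Deriv J) → CutFree D → LazyJ J →
        AllNodes (λ ρ → LazyJ (concl ρ)) D
        × AllNodes (λ ρ → ¬ Forbidden ρ) D)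
lemma5p4 =
    (λ σ cl lz → cl , lz)
  , closed⇒hasPos∀
  , forbidden⇒¬lazy
  , (λ ρ kind4 → lazy-premises (Instance.raw ρ) (kind4⇒¬cut ρ kind4))
  , cutFree-lazy
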